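{- Let $n$ be an odd number and $G$ a Steinhaus graph on vertices $V_1,\ldots,V_n$ whose Steinhaus matrix $M=(a_{i,j})$ is multi-symmetric. Then, viewing entries as integers $0,1$: $\deg(V_1)=\deg(V_n)\equiv 0\pmod 2$; $\deg(V_2)=\deg(V_{n-1})\equiv 2a_{1,\frac{n+1}{2}}\pmod 4$; $\deg(V_{2i})\equiv 2a_{i+1,2i+1}+2a_{2i-1,2i+1}+2a_{2i-1,\frac{n-1}{2}+i}\pmod 4$ for all $2\leq i\leq\frac{n-3}{2}$; $\deg(V_{2i+1})\equiv 2a_{2,2i+2}\pmod 4$ for all $1\leq i\leq \frac{n-3}{2}$.
   Context: A Steinhaus matrix of size $n\geq1$ is a matrix $M=(a_{i,j})_{1\leq i,j\leq n}$ with entries in $\mathbb{F}_2=\{0,1\}$ such that $a_{i,i}=0$ for all $i$, $a_{i,j}=a_{i-1,j-1}+a_{i-1,j}$ (addition in $\mathbb{F}_2$) for all $2\leq i<j\leq n$, and $a_{i,j}=a_{j,i}$ for all $i,j$. The Steinhaus graph associated with $M$ is the simple graph on vertices $V_1,\ldots,V_n$ with adjacency matrix $M$; $\deg(V_i)=\sum_j a_{i,j}$ as integers. A square matrix $(a_{i,j})$ of size $n$ is doubly-symmetric if $a_{i,j}=a_{j,i}=a_{n-j+1,n-i+1}$ for all $i,j$; it is multi-symmetric if it is doubly-symmetric and $a_{i,j}=a_{i,n-j+i+1}$ for all $1\leq i<j\leq n$. -}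

module Defs where

open import Data.Bool using (Bool; true; false; _xor_)
open import Data.Nat using (ℕ; zero; suc; _+_; _∸_; _≤_; _<_)
open import Data.Product using (_×_)
open import Relation.Binary.PropositionalEquality using (_≡_)

-- A square matrix of size n over F₂ = Bool (with xor as addition) is a
-- function  a : ℕ → ℕ → Bool  read with 1-based indices; only the entries
-- a i j with 1 ≤ i, j ≤ n matter.
Matrix : Set
Matrix = ℕ → ℕ → Bool

IsSteinhaus : ℕ → Matrix → Set
IsSteinhaus n a =
  (∀ i → 1 ≤ i → i ≤ n → a i i ≡ false) ×
  (∀ i j → 2 ≤ i → i < j → j ≤ n →
     a i j ≡ (a (i ∸ 1) (j ∸ 1) xor a (i ∸ 1) j)) ×
  (∀ i j → 1 ≤ i → i ≤ n → 1 ≤ j → j ≤ n → a i j ≡ a j i)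

IsDoublySymmetric : ℕ → Matrix → Set
IsDoublySymmetric n a =
  ∀ i j → 1 ≤ i → i ≤ n → 1 ≤ j → j ≤ n →
    (a i j ≡ a j i) × (a i j ≡ a (n ∸ j + 1) (n ∸ i + 1))

IsMultiSymmetric : ℕ → Matrix → Set
IsMultiSymmetric n a =
  IsDoublySymmetric n a ×
  (∀ i j → 1 ≤ i → i < j → j ≤ n → a i j ≡ a i (n ∸ j + i + 1))

b2n : Bool → ℕ
b2n true  = 1
b2n false = 0

rowSum : Matrix → ℕ → ℕ → ℕ
rowSum a i zero    = 0
rowSum a i (suc k) = b2n (a i (suc k)) + rowSum a i k

deg : ℕ → Matrix → ℕ → ℕ
deg n a i = rowSum a i n

-- Write n = k + 1 + m. By double symmetry the k entries of row k + 1 left of the diagonal are the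
-- first k entries of row m + 1 right of it, so deg V_{k+1} = upper (m+1) k + upper (k+1) m, where
-- upper c L counts the ones among the first L entries of row c right of the diagonal. Multi-symmetry
-- makes every such row segment a palindrome whose centre (for odd length) vanishes by Pascal's rule,
-- so both summands are doubles 2x and 2y and the degree is 2 (x + y) modulo 4. Pascal's rule also
-- telescopes a half-segment of row c + 1: x ≡ a(c, c+1) + a(c, c+1+L) (mod 2). The corner entries
-- obtained this way are matched with those of the statement by double symmetry.
module Submission where

open import Defs
open import Data.Bool using (Bool; true; false; not; _xor_)
open import Data.Bool.Properties
  using (xor-assoc; xor-comm; xor-same; xor-identityʳ; xor-annihilates-not; not-distribˡ-xor; not-involutive)
open import Data.Nat using (ℕ; zero; suc; _+_; _*_; _∸_; _≤_; _<_; _%_; _/_; z≤n; s≤s)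
open import Data.Nat.Properties
open import Data.Nat.DivMod using ([m+n]%n≡m%n; m*n%n≡0; m*n/n≡m; m≡m%n+[m/n]*n)
open import Data.Nat.Tactic.RingSolver using (solve-∀)
open import Data.Product using (∃; _×_; _,_; proj₁; proj₂)
open import Relation.Binary.PropositionalEquality
open ≡-Reasoning

count : (ℕ → Bool) → ℕ → ℕ
count h zero    = 0
count h (suc L) = count h L + b2n (h L)

count-cong : ∀ {h h'} L → (∀ t → t < L → h t ≡ h' t) → count h L ≡ count h' L
count-cong zero    h≗h' = refl
count-cong (suc L) h≗h' =
  cong₂ _+_ (count-cong L (λ t t<L → h≗h' t (m≤n⇒m≤1+n t<L))) (cong b2n (h≗h' L ≤-refl))

count-+ : ∀ h p q → count h (p + q) ≡ count h p + count (λ t → h (p + t)) q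
count-+ h p zero    = trans (cong (count h) (+-identityʳ p)) (sym (+-identityʳ _))
count-+ h p (suc q) = begin
  count h (p + suc q)                                      ≡⟨ cong (count h) (+-suc p q) ⟩
  count h (p + q) + b2n (h (p + q))                        ≡⟨ cong (_+ b2n (h (p + q))) (count-+ h p q) ⟩
  count h p + count (λ t → h (p + t)) q + b2n (h (p + q))  ≡⟨ +-assoc (count h p) _ _ ⟩
  count h p + count (λ t → h (p + t)) (suc q)              ∎

count-suc : ∀ h L → count h (suc L) ≡ b2n (h 0) + count (λ t → h (suc t)) L
count-suc h L = count-+ h 1 L

count-reverse : ∀ {h h'} L → (∀ t u → t + u + 1 ≡ L → h t ≡ h' u) → count h L ≡ count h' L
count-reverse          zero    _      = refl
count-reverse {h} {h'} (suc L) mirror = begin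
  count h (suc L)                        ≡⟨ count-suc h L ⟩
  b2n (h 0) + count (λ t → h (suc t)) L  ≡⟨ +-comm (b2n (h 0)) _ ⟩
  count (λ t → h (suc t)) L + b2n (h 0)
    ≡⟨ cong₂ _+_ (count-reverse L (λ t u e → mirror (suc t) u (cong suc e)))
                 (cong b2n (mirror 0 L (+-comm L 1))) ⟩
  count h' (suc L)                       ∎

rowSum≡count : ∀ (a : Matrix) i k → rowSum a i k ≡ count (λ t → a i (suc t)) k
rowSum≡count a i zero    = refl
rowSum≡count a i (suc k) =
  trans (+-comm (b2n (a i (suc k))) _) (cong (_+ b2n (a i (suc k))) (rowSum≡count a i k))

parity : ℕ → Bool
parity zero    = false
parity (suc x) = not (parity x)

parity-+ : ∀ x y → parity (x + y) ≡ parity x xor parity y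
parity-+ zero    y = refl
parity-+ (suc x) y = trans (cong not (parity-+ x y)) (not-distribˡ-xor (parity x) (parity y))

parity-b2n : ∀ b → parity (b2n b) ≡ b
parity-b2n true  = refl
parity-b2n false = refl

2*-%4 : ∀ x → 2 * x % 4 ≡ 2 * b2n (parity x)
2*-%4 0             = refl
2*-%4 1             = refl
2*-%4 (suc (suc x)) = begin
  2 * suc (suc x) % 4             ≡⟨ cong (λ y → 2 * y % 4) (+-comm 2 x) ⟩
  2 * (x + 2) % 4                 ≡⟨ cong (_% 4) (*-distribˡ-+ 2 x 2) ⟩
  (2 * x + 4) % 4                 ≡⟨ [m+n]%n≡m%n (2 * x) 4 ⟩
  2 * x % 4                       ≡⟨ 2*-%4 x ⟩
  2 * b2n (parity x)              ≡⟨ cong (λ b → 2 * b2n b) (sym (not-involutive (parity x))) ⟩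
  2 * b2n (parity (suc (suc x)))  ∎

doubles-%4 : ∀ x y → (x + x + (y + y)) % 4 ≡ 2 * b2n (parity x xor parity y)
doubles-%4 x y = begin
  (x + x + (y + y)) % 4            ≡⟨ cong (_% 4) (regroup x y) ⟩
  2 * (x + y) % 4                  ≡⟨ 2*-%4 (x + y) ⟩
  2 * b2n (parity (x + y))         ≡⟨ cong (λ b → 2 * b2n b) (parity-+ x y) ⟩
  2 * b2n (parity x xor parity y)  ∎
  where
  regroup : ∀ x y → x + x + (y + y) ≡ 2 * (x + y)
  regroup = solve-∀

2*b2n-%4 : ∀ b → 2 * b2n b % 4 ≡ 2 * b2n b
2*b2n-%4 true  = refl
2*b2n-%4 false = refl

2*b2n-sum-%4 : ∀ x y z → (2 * b2n x + 2 * b2n y + 2 * b2n z) % 4 ≡ 2 * b2n (x xor y xor z)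
2*b2n-sum-%4 true  true  true  = refl
2*b2n-sum-%4 true  true  false = refl
2*b2n-sum-%4 true  false true  = refl
2*b2n-sum-%4 true  false false = refl
2*b2n-sum-%4 false true  true  = refl
2*b2n-sum-%4 false true  false = refl
2*b2n-sum-%4 false false true  = refl
2*b2n-sum-%4 false false false = refl

xor-cancelˡ : ∀ x y z → (x xor y) xor (x xor z) ≡ y xor z
xor-cancelˡ false y z = refl
xor-cancelˡ true  y z = xor-annihilates-not y z

x+x≡x*2 : ∀ x → x + x ≡ x * 2
x+x≡x*2 = solve-∀

half-double : ∀ x → (x + x) / 2 ≡ x
half-double x = trans (cong (_/ 2) (x+x≡x*2 x)) (m*n/n≡m x 2)

odd-centre : ∀ N → (suc (N + N) ∸ 1) / 2 + 1 ≡ (suc (N + N) + 1) / 2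
odd-centre N = begin
  (N + N) / 2 + 1        ≡⟨ cong (_+ 1) (half-double N) ⟩
  N + 1                  ≡⟨ sym (m*n/n≡m (N + 1) 2) ⟩
  (N + 1) * 2 / 2        ≡⟨ cong (_/ 2) (double-suc N) ⟩
  (suc (N + N) + 1) / 2  ∎
  where
  double-suc : ∀ N → (N + 1) * 2 ≡ suc (N + N) + 1
  double-suc = solve-∀

odd-margin : ∀ N → (suc (N + N) ∸ 3) / 2 ≡ N ∸ 1
odd-margin zero    = refl
odd-margin (suc N) = trans (cong (λ x → (x ∸ 1) / 2) (+-suc N N)) (half-double N)

odd⇒≡1+half+half : ∀ n → n % 2 ≡ 1 → suc (n / 2 + n / 2) ≡ n
odd⇒≡1+half+half n n-odd = sym (begin
  n                    ≡⟨ m≡m%n+[m/n]*n n 2 ⟩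
  n % 2 + n / 2 * 2    ≡⟨ cong (_+ n / 2 * 2) n-odd ⟩
  1 + n / 2 * 2        ≡⟨ cong suc (sym (x+x≡x*2 (n / 2))) ⟩
  suc (n / 2 + n / 2)  ∎)

1≤x+[1+x] : ∀ x → 1 ≤ x + suc x
1≤x+[1+x] x = ≤-trans (s≤s z≤n) (m≤n+m (suc x) x)

m+[1+n]≡o⇒m<o : ∀ {m n o} → m + suc n ≡ o → m < o
m+[1+n]≡o⇒m<o {m} e = subst (m <_) e (m<m+n m (s≤s z≤n))

∸-mirror : ∀ {n} j j' → j + suc j' ≡ n → n ∸ suc j + 1 ≡ suc j'
∸-mirror j j' refl = begin
  j + suc j' ∸ suc j + 1  ≡⟨ cong (λ x → x ∸ suc j + 1) (+-suc j j') ⟩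
  j + j' ∸ j + 1          ≡⟨ cong (_+ 1) (m+n∸m≡n j j') ⟩
  j' + 1                  ≡⟨ +-comm j' 1 ⟩
  suc j'                  ∎

∸-palindrome : ∀ {n} c t u → suc c + t + u ≡ n → n ∸ (suc c + t) + c + 1 ≡ suc c + u
∸-palindrome c t u refl = begin
  suc c + t + u ∸ (suc c + t) + c + 1  ≡⟨ cong (λ x → x + c + 1) (m+n∸m≡n (suc c + t) u) ⟩
  u + c + 1                            ≡⟨ rotate u c ⟩
  suc c + u                            ∎
  where
  rotate : ∀ u c → u + c + 1 ≡ suc c + u
  rotate = solve-∀

module MultiSymmetric {n : ℕ} {a : Matrix} (steinhaus : IsSteinhaus n a) (multi : IsMultiSymmetric n a) where

  pascal : ∀ c j → 1 ≤ c → c < j → j < n → a (suc c) (suc j) ≡ a c j xor a c (suc j)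
  pascal c j 1≤c c<j j<n = proj₁ (proj₂ steinhaus) (suc c) (suc j) (s≤s 1≤c) (s≤s c<j) j<n

  reflect : ∀ i j i' j' → i + suc i' ≡ n → j + suc j' ≡ n →
            a (suc i) (suc j) ≡ a (suc j') (suc i')
  reflect i j i' j' ei ej =
    trans (proj₂ (proj₁ multi (suc i) (suc j) (s≤s z≤n) (m+[1+n]≡o⇒m<o ei)
                                              (s≤s z≤n) (m+[1+n]≡o⇒m<o ej)))
          (cong₂ a (∸-mirror j j' ej) (∸-mirror i i' ei))

  palindrome : ∀ c t u → 1 ≤ c → suc c + t + u ≡ n → a c (suc c + t) ≡ a c (suc c + u)
  palindrome c t u 1≤c e =
    trans (proj₂ multi c (suc c + t) 1≤c (s≤s (m≤m+n c t))
                 (m+n≤o⇒m≤o (suc c + t) (≤-reflexive e)))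
          (cong (a c) (∸-palindrome c t u e))

  -- a (p, q) = a (q - p, q): reflect, use the palindrome of row n + 1 - q, reflect back.
  column-mirror : ∀ i d → suc i + suc d ≤ n → a (suc i) (suc i + suc d) ≡ a (suc d) (suc i + suc d)
  column-mirror i d bound with m≤n⇒∃[o]m+o≡n bound
  ... | r , e = begin
    a (suc i) (suc (i + suc d))
      ≡⟨ reflect i (i + suc d) (suc d + r) r (by (shape₁ i d r)) (by (shape₂ i d r)) ⟩
    a (suc r) (suc (suc d + r))
      ≡⟨ cong (λ j → a (suc r) (suc (suc j))) (+-comm d r) ⟩
    a (suc r) (suc (suc r) + d)
      ≡⟨ palindrome (suc r) d i (s≤s z≤n) (by (shape₃ i d r)) ⟩
    a (suc r) (suc (suc r) + i)
      ≡⟨ reflect r (suc r + i) (i + suc d) d (by (shape₄ i d r)) (by (shape₅ i d r)) ⟩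
    a (suc d) (suc (i + suc d))
      ∎
    where
    by : ∀ {x} → x ≡ suc i + suc d + r → x ≡ n
    by shape = trans shape e
    shape₁ : ∀ i d r → i + suc (suc d + r) ≡ suc i + suc d + r
    shape₁ = solve-∀
    shape₂ : ∀ i d r → i + suc d + suc r ≡ suc i + suc d + r
    shape₂ = solve-∀
    shape₃ : ∀ i d r → suc (suc r) + d + i ≡ suc i + suc d + r
    shape₃ = solve-∀
    shape₄ : ∀ i d r → r + suc (i + suc d) ≡ suc i + suc d + r
    shape₄ = solve-∀
    shape₅ : ∀ i d r → suc r + i + suc d ≡ suc i + suc d + r
    shape₅ = solve-∀

  -- The two central entries of row c agree, so Pascal's rule kills the centre of row c + 1.
  middle-zero : ∀ c t → 1 ≤ c → suc c + t + suc t ≡ n → a (suc c) (suc (suc c + t)) ≡ false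
  middle-zero c t 1≤c e = begin
    a (suc c) (suc (suc c + t))
      ≡⟨ pascal c (suc c + t) 1≤c (s≤s (m≤m+n c t)) (m+[1+n]≡o⇒m<o e) ⟩
    a c (suc c + t) xor a c (suc (suc c + t))  ≡⟨ cong (a c (suc c + t) xor_) (sym twin) ⟩
    a c (suc c + t) xor a c (suc c + t)        ≡⟨ xor-same (a c (suc c + t)) ⟩
    false                                      ∎
    where
    twin : a c (suc c + t) ≡ a c (suc (suc c + t))
    twin = trans (palindrome c t (suc t) 1≤c e) (cong (a c) (+-suc (suc c) t))

  superdiagonal : ∀ k m → 1 ≤ k → k + suc (suc m) ≡ n →
                  a (suc m) (suc (suc m)) ≡ a k (suc k) xor a k (suc (suc k))
  superdiagonal k m 1≤k e =
    trans (reflect m (suc m) (suc k) k e' (trans (swap₁ k m) e))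
          (pascal k (suc k) 1≤k ≤-refl (m+n≤o⇒n≤o m (≤-reflexive e')))
    where
    swap₁ : ∀ k m → suc m + suc k ≡ k + suc (suc m)
    swap₁ = solve-∀
    swap₂ : ∀ k m → m + suc (suc k) ≡ k + suc (suc m)
    swap₂ = solve-∀
    e' : m + suc (suc k) ≡ n
    e' = trans (swap₂ k m) e

  upper : ℕ → ℕ → ℕ
  upper c L = count (λ t → a c (suc c + t)) L

  parity-upper : ∀ c h → 1 ≤ c → suc c + h ≤ n →
                 parity (upper (suc c) h) ≡ a c (suc c) xor a c (suc c + h)
  parity-upper c zero    1≤c _     =
    sym (trans (cong (λ j → a c (suc c) xor a c j) (+-identityʳ (suc c))) (xor-same (a c (suc c))))
  parity-upper c (suc h) 1≤c bound = begin
    parity (upper (suc c) h + b2n (a (suc c) (suc (suc c + h))))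
      ≡⟨ parity-+ (upper (suc c) h) _ ⟩
    parity (upper (suc c) h) xor parity (b2n (a (suc c) (suc (suc c + h))))
      ≡⟨ cong₂ _xor_ (parity-upper c h 1≤c (≤-trans (n≤1+n _) next<n))
                     (trans (parity-b2n _) (pascal c (suc c + h) 1≤c (s≤s (m≤m+n c h)) next<n)) ⟩
    (a c (suc c) xor a c (suc c + h)) xor (a c (suc c + h) xor a c (suc (suc c + h)))
      ≡⟨ cong (_xor (a c (suc c + h) xor a c (suc (suc c + h)))) (xor-comm (a c (suc c)) _) ⟩
    (a c (suc c + h) xor a c (suc c)) xor (a c (suc c + h) xor a c (suc (suc c + h)))
      ≡⟨ xor-cancelˡ (a c (suc c + h)) _ _ ⟩
    a c (suc c) xor a c (suc (suc c + h))
      ≡⟨ cong (λ j → a c (suc c) xor a c j) (sym (+-suc (suc c) h)) ⟩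
    a c (suc c) xor a c (suc c + suc h)
      ∎
    where
    next<n : suc (suc c + h) ≤ n
    next<n = subst (_≤ n) (+-suc (suc c) h) bound

  parity-upper-half : ∀ c h → 1 ≤ c → suc c + h + suc h ≡ n →
                      parity (upper (suc (suc c)) h) ≡ a (suc c) (suc (suc c))
  parity-upper-half c h 1≤c e = begin
    parity (upper (suc (suc c)) h)
      ≡⟨ parity-upper (suc c) h (s≤s z≤n) (m+[1+n]≡o⇒m<o e) ⟩
    a (suc c) (suc (suc c)) xor a (suc c) (suc (suc c + h))
      ≡⟨ cong (a (suc c) (suc (suc c)) xor_) (middle-zero c h 1≤c e) ⟩
    a (suc c) (suc (suc c)) xor false
      ≡⟨ xor-identityʳ _ ⟩
    a (suc c) (suc (suc c))
      ∎

  upper-even : ∀ c h → 1 ≤ c → c + (h + h) ≡ n → upper c (h + h) ≡ upper c h + upper c h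
  upper-even c h 1≤c e =
    trans (count-+ (λ t → a c (suc c + t)) h h)
          (cong (upper c h +_) (count-reverse h (λ t u t+u+1≡h →
            palindrome c (h + t) u 1≤c (trans (shape c t+u+1≡h) e))))
    where
    shape : ∀ {h t u} c → t + u + 1 ≡ h → suc c + (h + t) + u ≡ c + (h + h)
    shape {t = t} {u} c refl = lemma c t u
      where
      lemma : ∀ c t u → suc c + (t + u + 1 + t) + u ≡ c + (t + u + 1 + (t + u + 1))
      lemma = solve-∀

  upper-odd : ∀ c h → 1 ≤ c → suc c + h + suc h ≡ n →
              upper (suc c) (suc h + h) ≡ upper (suc c) h + upper (suc c) h
  upper-odd c h 1≤c e = begin
    upper (suc c) (suc h + h)
      ≡⟨ cong (upper (suc c)) (+-comm (suc h) h) ⟩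
    upper (suc c) (h + suc h)
      ≡⟨ count-+ row h (suc h) ⟩
    upper (suc c) h + count (λ t → row (h + t)) (suc h)
      ≡⟨ cong (upper (suc c) h +_) (count-suc _ h) ⟩
    upper (suc c) h + (b2n (row (h + 0)) + count (λ t → row (h + suc t)) h)
      ≡⟨ cong (λ x → upper (suc c) h + (b2n x + count (λ t → row (h + suc t)) h)) centre ⟩
    upper (suc c) h + count (λ t → row (h + suc t)) h
      ≡⟨ cong (upper (suc c) h +_) (count-reverse h mirror) ⟩
    upper (suc c) h + upper (suc c) h
      ∎
    where
    row : ℕ → Bool
    row t = a (suc c) (suc (suc c) + t)
    centre : row (h + 0) ≡ false
    centre = trans (cong row (+-identityʳ h)) (middle-zero c h 1≤c e)
    shape : ∀ {h t u} c → t + u + 1 ≡ h → suc (suc c) + (h + suc t) + u ≡ suc c + h + suc h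
    shape {t = t} {u} c refl = lemma c t u
      where
      lemma : ∀ c t u → suc (suc c) + (t + u + 1 + suc t) + u ≡ suc c + (t + u + 1) + suc (t + u + 1)
      lemma = solve-∀
    mirror : ∀ t u → t + u + 1 ≡ h → row (h + suc t) ≡ row u
    mirror t u t+u+1≡h = palindrome (suc c) (h + suc t) u (s≤s z≤n) (trans (shape c t+u+1≡h) e)

  deg-split : ∀ k m → k + suc m ≡ n → deg n a (suc k) ≡ upper (suc m) k + upper (suc k) m
  deg-split k m e = begin
    deg n a (suc k)                                  ≡⟨ rowSum≡count a (suc k) n ⟩
    count row n                                      ≡⟨ cong (count row) (sym e) ⟩
    count row (k + suc m)                            ≡⟨ count-+ row k (suc m) ⟩
    count row k + count (λ t → row (k + t)) (suc m)  ≡⟨ cong₂ _+_ left right ⟩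
    upper (suc m) k + upper (suc k) m                ∎
    where
    row : ℕ → Bool
    row t = a (suc k) (suc t)
    diagonal : row (k + 0) ≡ false
    diagonal = trans (cong row (+-identityʳ k)) (proj₁ steinhaus (suc k) (s≤s z≤n) (m+[1+n]≡o⇒m<o e))
    right : count (λ t → row (k + t)) (suc m) ≡ upper (suc k) m
    right = trans (count-suc (λ t → row (k + t)) m)
                  (cong₂ _+_ (cong b2n diagonal) (count-cong m (λ t _ → cong row (+-suc k t))))
    shape : ∀ {t u} → t + u + 1 ≡ k → t + suc (suc m + u) ≡ k + suc m
    shape {t} {u} refl = lemma t u m
      where
      lemma : ∀ t u m → t + suc (suc m + u) ≡ t + u + 1 + suc m
      lemma = solve-∀
    left : count row k ≡ upper (suc m) k
    left = count-reverse k λ t u t+u+1≡k →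
      let e' = trans (shape t+u+1≡k) e in
      trans (reflect k t m (suc m + u) e e')
            (proj₂ (proj₂ steinhaus) (suc (suc m + u)) (suc m)
                   (s≤s z≤n) (m+n≤o⇒n≤o t (≤-reflexive e'))
                   (s≤s z≤n) (m+n≤o⇒n≤o k (≤-reflexive e)))

  deg-reflect : ∀ k m → k + suc m ≡ n → deg n a (suc k) ≡ deg n a (suc m)
  deg-reflect k m e =
    trans (deg-split k m e)
          (trans (+-comm (upper (suc m) k) _) (sym (deg-split m k (trans (swap m k) e))))
    where
    swap : ∀ m k → m + suc k ≡ k + suc m
    swap = solve-∀

  deg-%4 : ∀ k m x y → k + suc m ≡ n → upper (suc m) k ≡ x + x → upper (suc k) m ≡ y + y →
           deg n a (suc k) % 4 ≡ 2 * b2n (parity x xor parity y)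
  deg-%4 k m x y e ex ey = trans (cong (_% 4) (trans (deg-split k m e) (cong₂ _+_ ex ey))) (doubles-%4 x y)

  deg-first : ∀ N → suc (N + N) ≡ n → (deg n a 1 ≡ deg n a n) × (deg n a 1 % 2 ≡ 0)
  deg-first N e = trans (deg-reflect 0 (N + N) e) (cong (deg n a) e) , (begin
    deg n a 1 % 2                ≡⟨ cong (_% 2) (deg-split 0 (N + N) e) ⟩
    upper 1 (N + N) % 2          ≡⟨ cong (_% 2) (upper-even 1 N ≤-refl e) ⟩
    (upper 1 N + upper 1 N) % 2  ≡⟨ cong (_% 2) (x+x≡x*2 (upper 1 N)) ⟩
    upper 1 N * 2 % 2            ≡⟨ m*n%n≡0 (upper 1 N) 2 ⟩
    0                            ∎)

  deg-even-%4 : ∀ i j → 1 ≤ i → suc (i + j + (i + j)) ≡ n →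
    deg n a (2 * i) % 4 ≡
      (2 * b2n (a (i + 1) (2 * i + 1)) + 2 * b2n (a (2 * i ∸ 1) (2 * i + 1))
        + 2 * b2n (a (2 * i ∸ 1) ((n ∸ 1) / 2 + i))) % 4
  deg-even-%4 (suc p) j _ size = begin
    deg n a (2 * suc p) % 4
      ≡⟨ cong (λ v → deg n a v % 4) (vertex p) ⟩
    deg n a (suc k) % 4
      ≡⟨ deg-%4 k m (upper M p) (upper K j) (by (shape₁ p j))
                (upper-odd m p (s≤s z≤n) (by (shape₂ p j)))
                (upper-odd k j (s≤s z≤n) (by (shape₃ p j))) ⟩
    2 * b2n (parity (upper M p) xor parity (upper K j))
      ≡⟨ cong (λ b → 2 * b2n b) parities ⟩
    2 * b2n (b₁ xor b₂ xor b₃)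
      ≡⟨ sym (2*b2n-sum-%4 b₁ b₂ b₃) ⟩
    (2 * b2n b₁ + 2 * b2n b₂ + 2 * b2n b₃) % 4
      ∎
    where
    k m K M : ℕ
    k = suc p + p
    m = suc j + j
    K = suc k
    M = suc m
    b₁ b₂ b₃ : Bool
    b₁ = a (suc p + 1) (2 * suc p + 1)
    b₂ = a (2 * suc p ∸ 1) (2 * suc p + 1)
    b₃ = a (2 * suc p ∸ 1) ((n ∸ 1) / 2 + suc p)
    vertex : ∀ p → 2 * suc p ≡ suc (suc p + p)
    vertex = solve-∀
    by : ∀ {x} → x ≡ suc (suc p + j + (suc p + j)) → x ≡ n
    by shape = trans shape size
    shape₁ : ∀ p j → suc p + p + suc (suc j + j) ≡ suc (suc p + j + (suc p + j))
    shape₁ = solve-∀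
    shape₂ : ∀ p j → suc (suc j + j) + p + suc p ≡ suc (suc p + j + (suc p + j))
    shape₂ = solve-∀
    shape₃ : ∀ p j → suc (suc p + p) + j + suc j ≡ suc (suc p + j + (suc p + j))
    shape₃ = solve-∀
    shape₄ : ∀ p j → j + j + suc (suc (suc p + p)) ≡ suc (suc p + j + (suc p + j))
    shape₄ = solve-∀
    shape₅ : ∀ p j → suc j + j + p + suc (suc p) ≡ suc (suc p + j + (suc p + j))
    shape₅ = solve-∀
    far : a m (M + p) ≡ a (suc (suc p)) (suc K)
    far = reflect (j + j) (m + p) K (suc p) (by (shape₄ p j)) (by (shape₅ p j))
    indices : a (suc (suc p)) (suc K) xor a k (suc K) xor a k (K + j) ≡ b₁ xor b₂ xor b₃
    indices = sym (cong₂ _xor_ (cong₂ a (+-comm (suc p) 1) column)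
                               (cong₂ _xor_ (cong₂ a row column) (cong₂ a row middle)))
      where
      column : 2 * suc p + 1 ≡ suc K
      column = trans (cong (_+ 1) (vertex p)) (+-comm K 1)
      row : 2 * suc p ∸ 1 ≡ k
      row = cong (_∸ 1) (vertex p)
      regroup : ∀ p j → suc p + j + suc p ≡ suc (suc p + p) + j
      regroup = solve-∀
      middle : (n ∸ 1) / 2 + suc p ≡ K + j
      middle = begin
        (n ∸ 1) / 2 + suc p                    ≡⟨ cong (λ x → (x ∸ 1) / 2 + suc p) (sym size) ⟩
        (suc p + j + (suc p + j)) / 2 + suc p  ≡⟨ cong (_+ suc p) (half-double (suc p + j)) ⟩
        suc p + j + suc p                      ≡⟨ regroup p j ⟩
        K + j                                  ∎
    parities : parity (upper M p) xor parity (upper K j) ≡ b₁ xor b₂ xor b₃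
    parities = begin
      parity (upper M p) xor parity (upper K j)
        ≡⟨ cong₂ _xor_
             (parity-upper m p (s≤s z≤n) (m+[1+n]≡o⇒m<o (by (shape₅ p j))))
             (parity-upper k j (s≤s z≤n) (m+n≤o⇒m≤o (K + j) (≤-reflexive (by (shape₃ p j))))) ⟩
      (a m M xor a m (M + p)) xor (a k K xor a k (K + j))
        ≡⟨ cong₂ (λ x y → (x xor y) xor (a k K xor a k (K + j)))
                 (superdiagonal k (j + j) (s≤s z≤n) (by (shape₁ p j))) far ⟩
      ((a k K xor a k (suc K)) xor a (suc (suc p)) (suc K)) xor (a k K xor a k (K + j))
        ≡⟨ cong (_xor (a k K xor a k (K + j))) (xor-assoc (a k K) _ _) ⟩
      (a k K xor (a k (suc K) xor a (suc (suc p)) (suc K))) xor (a k K xor a k (K + j))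
        ≡⟨ xor-cancelˡ (a k K) _ _ ⟩
      (a k (suc K) xor a (suc (suc p)) (suc K)) xor a k (K + j)
        ≡⟨ cong (_xor a k (K + j)) (xor-comm (a k (suc K)) _) ⟩
      (a (suc (suc p)) (suc K) xor a k (suc K)) xor a k (K + j)
        ≡⟨ xor-assoc (a (suc (suc p)) (suc K)) _ _ ⟩
      a (suc (suc p)) (suc K) xor a k (suc K) xor a k (K + j)
        ≡⟨ indices ⟩
      b₁ xor b₂ xor b₃
        ∎

  deg-second : ∀ N → suc (N + N) ≡ n → 3 ≤ n →
    (deg n a 2 ≡ deg n a (n ∸ 1)) × (deg n a 2 % 4 ≡ 2 * b2n (a 1 ((n + 1) / 2)) % 4)
  deg-second zero    size 3≤n with s≤s () ← subst (3 ≤_) (sym size) 3≤n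
  deg-second (suc j) size 3≤n =
    trans (deg-reflect 1 (j + suc j) size) (cong (λ x → deg n a (x ∸ 1)) size) , (begin
      deg n a 2 % 4
        ≡⟨ deg-even-%4 1 j (s≤s z≤n) size ⟩
      (2 * b2n (a 2 3) + 2 * b2n (a 1 3) + 2 * b2n (a 1 c)) % 4
        ≡⟨ 2*b2n-sum-%4 (a 2 3) (a 1 3) (a 1 c) ⟩
      2 * b2n (a 2 3 xor a 1 3 xor a 1 c)
        ≡⟨ cong (λ b → 2 * b2n (b xor a 1 3 xor a 1 c)) a₂₃ ⟩
      2 * b2n (a 1 3 xor a 1 3 xor a 1 c)
        ≡⟨ cong (λ b → 2 * b2n b) (sym (xor-assoc (a 1 3) _ _)) ⟩
      2 * b2n ((a 1 3 xor a 1 3) xor a 1 c)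
        ≡⟨ cong (λ b → 2 * b2n (b xor a 1 c)) (xor-same (a 1 3)) ⟩
      2 * b2n (a 1 c)
        ≡⟨ cong (λ x → 2 * b2n (a 1 x)) centre ⟩
      2 * b2n (a 1 ((n + 1) / 2))
        ≡⟨ sym (2*b2n-%4 (a 1 ((n + 1) / 2))) ⟩
      2 * b2n (a 1 ((n + 1) / 2)) % 4
        ∎)
    where
    c : ℕ
    c = (n ∸ 1) / 2 + 1
    centre : c ≡ (n + 1) / 2
    centre = subst (λ n → (n ∸ 1) / 2 + 1 ≡ (n + 1) / 2) size (odd-centre (suc j))
    shape : ∀ j → suc (j + suc j) + 0 + 1 ≡ suc (suc j + suc j)
    shape = solve-∀
    a₁₂ : a 1 2 ≡ false
    a₁₂ = begin
      a 1 2
        ≡⟨ reflect 0 1 (suc (j + suc j)) (j + suc j) size size ⟩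
      a (suc (j + suc j)) (suc (suc (j + suc j)))
        ≡⟨ cong (λ x → a (suc (j + suc j)) (suc x)) (sym (+-identityʳ _)) ⟩
      a (suc (j + suc j)) (suc (suc (j + suc j) + 0))
        ≡⟨ middle-zero (j + suc j) 0 (≤-trans (s≤s z≤n) (m≤n+m (suc j) j)) (trans (shape j) size) ⟩
      false
        ∎
    a₂₃ : a 2 3 ≡ a 1 3
    a₂₃ = trans (pascal 1 2 (s≤s z≤n) ≤-refl 3≤n) (cong (_xor a 1 3) a₁₂)

  deg-odd-%4 : ∀ i j → 1 ≤ i → 1 ≤ j → suc (i + j + (i + j)) ≡ n →
    deg n a (2 * i + 1) % 4 ≡ 2 * b2n (a 2 (2 * i + 2)) % 4
  deg-odd-%4 (suc p) (suc q) _ _ size = begin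
    deg n a (2 * suc p + 1) % 4
      ≡⟨ cong (λ v → deg n a (v + 1) % 4) (vertex p) ⟩
    deg n a (k + 1) % 4
      ≡⟨ cong (λ v → deg n a v % 4) (+-comm k 1) ⟩
    deg n a (suc k) % 4
      ≡⟨ deg-%4 k m (upper M i) (upper K j) (by (shape₁ p q))
                (upper-even M i (s≤s z≤n) (by (shape₂ p q)))
                (upper-even K j (s≤s z≤n) (by (shape₃ p q))) ⟩
    2 * b2n (parity (upper M i) xor parity (upper K j))
      ≡⟨ cong (λ b → 2 * b2n b) parities ⟩
    2 * b2n (a 2 (2 * suc p + 2))
      ≡⟨ sym (2*b2n-%4 (a 2 (2 * suc p + 2))) ⟩
    2 * b2n (a 2 (2 * suc p + 2)) % 4
      ∎
    where
    i j k m K M : ℕ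
    i = suc p
    j = suc q
    k = i + i
    m = j + j
    K = suc k
    M = suc m
    vertex : ∀ p → 2 * suc p ≡ suc p + suc p
    vertex = solve-∀
    by : ∀ {x} → x ≡ suc (suc p + suc q + (suc p + suc q)) → x ≡ n
    by shape = trans shape size
    shape₁ : ∀ p q → suc p + suc p + suc (suc q + suc q) ≡ suc (suc p + suc q + (suc p + suc q))
    shape₁ = solve-∀
    shape₂ : ∀ p q → suc (suc q + suc q) + (suc p + suc p) ≡ suc (suc p + suc q + (suc p + suc q))
    shape₂ = solve-∀
    shape₃ : ∀ p q → suc (suc p + suc p) + (suc q + suc q) ≡ suc (suc p + suc q + (suc p + suc q))
    shape₃ = solve-∀
    shape₄ : ∀ p q → suc q + suc q + suc p + suc (suc p) ≡ suc (suc p + suc q + (suc p + suc q))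
    shape₄ = solve-∀
    shape₅ : ∀ p q → suc p + suc p + suc q + suc (suc q) ≡ suc (suc p + suc q + (suc p + suc q))
    shape₅ = solve-∀
    shape₆ : ∀ p q → suc p + suc p + suc (suc (q + suc q)) ≡ suc (suc p + suc q + (suc p + suc q))
    shape₆ = solve-∀
    shape₇ : ∀ p q → q + suc q + suc (suc (suc p + suc p)) ≡ suc (suc p + suc q + (suc p + suc q))
    shape₇ = solve-∀
    K<n : K < n
    K<n = m+n≤o⇒n≤o (q + suc q) (≤-reflexive (by (shape₇ p q)))
    parities : parity (upper M i) xor parity (upper K j) ≡ a 2 (2 * suc p + 2)
    parities = begin
      parity (upper M i) xor parity (upper K j)
        ≡⟨ cong₂ _xor_ (trans (parity-upper-half (q + suc q) i (1≤x+[1+x] q) (by (shape₄ p q)))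
                              (superdiagonal k (q + suc q) (s≤s z≤n) (by (shape₆ p q))))
                       (parity-upper-half (p + suc p) j (1≤x+[1+x] p) (by (shape₅ p q))) ⟩
      (a k K xor a k (suc K)) xor a k K          ≡⟨ xor-comm (a k K xor a k (suc K)) (a k K) ⟩
      a k K xor (a k K xor a k (suc K))          ≡⟨ sym (xor-assoc (a k K) (a k K) (a k (suc K))) ⟩
      (a k K xor a k K) xor a k (suc K)          ≡⟨ cong (_xor a k (suc K)) (xor-same (a k K)) ⟩
      a k (suc K)                                ≡⟨ cong (a k) (+-comm 2 k) ⟩
      a k (k + 2)
        ≡⟨ column-mirror (p + suc p) 1 (subst (_≤ n) (+-comm 2 k) K<n) ⟩
      a 2 (k + 2)                                ≡⟨ cong (λ v → a 2 (v + 2)) (sym (vertex p)) ⟩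
      a 2 (2 * suc p + 2)                        ∎

below-half : ∀ {n} N i → suc (N + N) ≡ n → 1 ≤ i → i ≤ (n ∸ 3) / 2 →
             ∃ λ j → suc (i + suc j + (i + suc j)) ≡ n
below-half zero    (suc i) refl _ ()
below-half (suc N) i       refl _ i≤ with m≤n⇒∃[o]m+o≡n (subst (i ≤_) (odd-margin (suc N)) i≤)
... | j , i+j≡N = j , cong (λ x → suc (x + x)) (trans (+-suc i j) (cong suc i+j≡N))

proposition8 : (n : ℕ) → (a : Matrix) → n % 2 ≡ 1 →
    IsSteinhaus n a → IsMultiSymmetric n a →
    ((deg n a 1 ≡ deg n a n) × (deg n a 1 % 2 ≡ 0)) ×
    (3 ≤ n →
      (deg n a 2 ≡ deg n a (n ∸ 1)) ×
      (deg n a 2 % 4 ≡ (2 * b2n (a 1 ((n + 1) / 2))) % 4)) ×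
    (∀ i → 2 ≤ i → i ≤ (n ∸ 3) / 2 →
      deg n a (2 * i) % 4 ≡
        (2 * b2n (a (i + 1) (2 * i + 1)) + 2 * b2n (a (2 * i ∸ 1) (2 * i + 1))
          + 2 * b2n (a (2 * i ∸ 1) ((n ∸ 1) / 2 + i))) % 4) ×
    (∀ i → 1 ≤ i → i ≤ (n ∸ 3) / 2 →
      deg n a (2 * i + 1) % 4 ≡ (2 * b2n (a 2 (2 * i + 2))) % 4)
proposition8 n a n-odd steinhaus multi =
  deg-first N size ,
  deg-second N size ,
  (λ i 2≤i i≤ → let 1≤i = ≤-trans (s≤s z≤n) 2≤i
                    (j , size′) = below-half N i size 1≤i i≤
                in deg-even-%4 i (suc j) 1≤i size′) ,
  (λ i 1≤i i≤ → let (j , size′) = below-half N i size 1≤i i≤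
                in deg-odd-%4 i (suc j) 1≤i (s≤s z≤n) size′)
  where
  open MultiSymmetric steinhaus multi
  N : ℕ
  N = n / 2
  size : suc (N + N) ≡ n
  size = odd⇒≡1+half+half n n-odd
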